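{- Let $R$ be a commutative ring, let $r\ge 1$, and let $A$ be a $3\times 3$ matrix over $R$ with columns $A_1,A_2,A_3$. Let $(a_i)_{i\ge1}$, $(b_i)_{i\ge2}$, $(c_i)_{i\ge3}$ be sequences in $R$, and define columns \[A_{3+i}=a_iA_i+b_{i+1}A_{i+1}+c_{i+2}A_{i+2},\qquad i=1,\dots,r.\] Let $P$ be the $(r+2)\times r$ matrix with $P_{j,j}=a_j$, $P_{j+1,j}=b_{j+1}$, $P_{j+2,j}=c_{j+2}$, $P_{j+3,j}=-1$ (whenever these row indices are at most $r+2$), and all other entries $0$. Let $0\le k<m\le r+1$ be integers, and let $Q_{22}$ be the $(r-k)\times(r-k)$ submatrix of $P$ formed by the rows with indices in $\{k+2,k+3,\dots,r+2\}\setminus\{m+1\}$ and the columns with indices $k+1,\dots,r$ (with $\det$ of a $0\times 0$ matrix equal to $1$). Then \[\det\,[A_{k+1}|A_{m+1}|A_{r+3}]=(-1)^{m+k+1}\,a_1a_2\cdots a_k\cdot\det Q_{22}\cdot\det A.\] -}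

module Defs where

open import Algebra.Bundles using (CommutativeRing)
open import Data.Nat as ℕ using (ℕ; zero; suc)
open import Data.Nat.Properties using () renaming (_≟_ to _≟ℕ_; _<?_ to _<?ℕ_)
open import Data.Fin using (Fin; zero; suc; toℕ; punchIn)
open import Relation.Nullary using (yes; no)

module WithRing {c ℓ} (R : CommutativeRing c ℓ) where
  open CommutativeRing R hiding (zero)

  ∑ : (n : ℕ) → (Fin n → Carrier) → Carrier
  ∑ zero    f = 0#
  ∑ (suc n) f = f zero + ∑ n (λ j → f (suc j))

  sgn : ℕ → Carrier
  sgn zero    = 1#
  sgn (suc n) = - sgn n

  -- Square matrices as functions: M i j = entry in row i, column j.
  Matrix : ℕ → Set c
  Matrix n = Fin n → Fin n → Carrier

  det : (n : ℕ) → Matrix n → Carrier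
  det zero    M = 1#
  det (suc n) M = ∑ (suc n) (λ j → sgn (toℕ j) * (M zero j * det n (λ i l → M (suc i) (punchIn j l))))

  Col3 : Set c
  Col3 = Fin 3 → Carrier

  det3cols : Col3 → Col3 → Col3 → Carrier
  det3cols u v w = det 3 M
    where
      M : Matrix 3
      M i zero                   = u i
      M i (suc zero)             = v i
      M i (suc (suc zero))       = w i

  -- Index 0 is unused (set to the zero column).
  col : Matrix 3 → (ℕ → Carrier) → (ℕ → Carrier) → (ℕ → Carrier) → ℕ → Col3
  col A a b cc zero                            = λ _ → 0#
  col A a b cc (suc zero)                      = λ i → A i zero
  col A a b cc (suc (suc zero))                = λ i → A i (suc zero)
  col A a b cc (suc (suc (suc zero)))          = λ i → A i (suc (suc zero))
  col A a b cc (suc (suc (suc (suc i))))       = λ x →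
      a (suc i) * col A a b cc (suc i) x
    + b (suc (suc i)) * col A a b cc (suc (suc i)) x
    + cc (suc (suc (suc i))) * col A a b cc (suc (suc (suc i))) x

  Pentry : (ℕ → Carrier) → (ℕ → Carrier) → (ℕ → Carrier) → ℕ → ℕ → Carrier
  Pentry a b cc i j with i ≟ℕ j
  ... | yes _ = a j
  ... | no _ with i ≟ℕ (j ℕ.+ 1)
  ...   | yes _ = b i
  ...   | no _ with i ≟ℕ (j ℕ.+ 2)
  ...     | yes _ = cc i
  ...     | no _ with i ≟ℕ (j ℕ.+ 3)
  ...       | yes _ = - 1#
  ...       | no _ = 0#

  -- The t-th (0-based) element, in increasing order, of {k+2, ..., r+2} \ {m+1}.
  Qrow : ℕ → ℕ → ℕ → ℕ
  Qrow k m t with (k ℕ.+ 2 ℕ.+ t) <?ℕ (m ℕ.+ 1)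
  ... | yes _ = k ℕ.+ 2 ℕ.+ t
  ... | no _  = k ℕ.+ 3 ℕ.+ t

  Q22 : (ℕ → Carrier) → (ℕ → Carrier) → (ℕ → Carrier) → (r k m : ℕ) → Matrix (r ℕ.∸ k)
  Q22 a b cc r k m t s = Pentry a b cc (Qrow k m (toℕ t)) (k ℕ.+ 1 ℕ.+ toℕ s)

  prodA : (ℕ → Carrier) → ℕ → Carrier
  prodA a zero    = 1#
  prodA a (suc k) = prodA a k * a (suc k)

-- Write W_j for the columns generated in the same way from the identity matrix,
-- m = k+s+1 and n = r-k.
--  1. Multiplication by a matrix commutes with the recurrence, so A_j = A·W_j and,
--     by multiplicativity of det, the left side is det A · det [W_{k+1}|W_{m+1}|W_{r+3}].
--  2. W_{j+1} = B·W′_j, where B is the companion matrix of (a₁, b₂, c₃) (det B = a₁)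
--     and W′ is built from the shifted coefficients.  Peeling k times leaves
--     a₁⋯a_k · det [e₁ | W⁽ᵏ⁾_{s+2} | W⁽ᵏ⁾_{n+3}].
--  3. Q22 is the core matrix (rows {2,…,n+2} ∖ {s+2}, columns 1,…,n of P) of the
--     coefficients shifted by k.  Expanding core determinants along the first row
--     gives a recurrence in (n, s); the signed minors (-1)^s det [e₁|W_{s+2}|W_{n+3}]
--     obey the same recurrence (polynomial identities for companion matrices), so
--     the two agree whenever s ≤ n.
--  4. (-1)^{m+k+1} = (-1)^s.
module Submission where

open import Defs
open import Algebra.Bundles using (CommutativeRing)
open import Algebra.Bundles.Raw using (RawRing)
open import Algebra.Solver.Ring.AlmostCommutativeRing
  using (fromCommutativeRing; _-Raw-AlmostCommutative⟶_)
open import Data.Fin using (Fin; zero; suc; toℕ; punchIn)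
open import Data.Integer as ℤ using (ℤ; +_; -[1+_]; _⊖_)
import Data.Integer.Properties as ℤP
open import Data.Maybe using (Maybe; just; nothing)
open import Data.Product using (_,_)
open import Data.Nat as ℕ using (ℕ; zero; suc)
import Data.Nat.Properties as ℕP
open import Data.Nat.Properties using () renaming (_≟_ to _≟ℕ_; _<?_ to _<?ℕ_)
import Data.Nat.Tactic.RingSolver as ℕ-Solver
open import Data.Empty using (⊥-elim)
open import Data.Sign as Sign using (Sign)
open import Relation.Binary.PropositionalEquality as ≡ using (_≡_)
open import Relation.Nullary using (yes; no)
open import Level using (_⊔_)

-- skip s t: the t-th element of ℕ ∖ {s}.
skip : ℕ → ℕ → ℕ
skip zero    t       = suc t
skip (suc s) zero    = zero
skip (suc s) (suc t) = suc (skip s t)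

skip-below : ∀ s t → t ℕ.< s → skip s t ≡ t
skip-below (suc s) zero    _         = ≡.refl
skip-below (suc s) (suc t) (ℕ.s≤s p) = ≡.cong suc (skip-below s t p)

skip-above : ∀ s t → s ℕ.≤ t → skip s t ≡ suc t
skip-above zero    t       _         = ≡.refl
skip-above (suc s) (suc t) (ℕ.s≤s p) = ≡.cong suc (skip-above s t p)

-- The comparison made by Qrow k (k+s+1) at position t is equivalent to t < s.
Qrow-bound : ∀ k s → suc (k ℕ.+ s) ℕ.+ 1 ≡ k ℕ.+ (2 ℕ.+ s)
Qrow-bound = ℕ-Solver.solve-∀

Qrow-test⇒< : ∀ k {s t} → k ℕ.+ 2 ℕ.+ t ℕ.< suc (k ℕ.+ s) ℕ.+ 1 → t ℕ.< s
Qrow-test⇒< k {s} {t} lt = ℕP.≤-pred (ℕP.≤-pred (ℕP.+-cancelˡ-< k (2 ℕ.+ t) (2 ℕ.+ s)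
  (≡.subst₂ ℕ._<_ (ℕP.+-assoc k 2 t) (Qrow-bound k s) lt)))

<⇒Qrow-test : ∀ k {s t} → t ℕ.< s → k ℕ.+ 2 ℕ.+ t ℕ.< suc (k ℕ.+ s) ℕ.+ 1
<⇒Qrow-test k {s} {t} lt = ≡.subst₂ ℕ._<_ (≡.sym (ℕP.+-assoc k 2 t)) (≡.sym (Qrow-bound k s))
  (ℕP.+-monoʳ-< k (ℕ.s≤s (ℕ.s≤s lt)))

cong₃ : ∀ {a b c d} {A : Set a} {B : Set b} {C : Set c} {D : Set d} (f : A → B → C → D) {x x′ y y′ z z′} →
        x ≡ x′ → y ≡ y′ → z ≡ z′ → f x y z ≡ f x′ y′ z′
cong₃ f ≡.refl ≡.refl ≡.refl = ≡.refl

-- The column indices of the theorem, written for m = k+s+1 and r = k+n.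
second-index : ∀ k s → suc (k ℕ.+ s) ℕ.+ 1 ≡ suc (k ℕ.+ suc s)
second-index = ℕ-Solver.solve-∀

third-index : ∀ {k r} → k ℕ.≤ r → r ℕ.+ 3 ≡ suc (k ℕ.+ suc (suc (r ℕ.∸ k)))
third-index {k} {r} k≤r = ≡.trans (≡.cong (ℕ._+ 3) (≡.sym (ℕP.m+[n∸m]≡n k≤r))) (rearrange k (r ℕ.∸ k))
  where
  rearrange : ∀ k n → k ℕ.+ n ℕ.+ 3 ≡ suc (k ℕ.+ suc (suc n))
  rearrange = ℕ-Solver.solve-∀

-- The sign exponent m+k+1 = s + 2(k+1) has the parity of s.
sign-index : ∀ k s → suc (k ℕ.+ s) ℕ.+ k ℕ.+ 1 ≡ s ℕ.+ (suc k ℕ.+ suc k)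
sign-index = ℕ-Solver.solve-∀

bounded : ∀ {k s r} → suc (k ℕ.+ s) ℕ.≤ r ℕ.+ 1 → k ℕ.+ s ℕ.≤ r
bounded {k} {s} {r} m≤ = ℕP.≤-pred (≡.subst (suc (k ℕ.+ s) ℕ.≤_) (ℕP.+-comm r 1) m≤)

s≤r∸k : ∀ {k s r} → k ℕ.+ s ℕ.≤ r → s ℕ.≤ r ℕ.∸ k
s≤r∸k {k} {s} k+s≤r = ≡.subst (ℕ._≤ _) (ℕP.m+n∸m≡n k s) (ℕP.∸-monoˡ-≤ k k+s≤r)

pattern 0F = zero
pattern 1F = suc zero
pattern 2F = suc (suc zero)

-- We use the integers
-- with their canonical map ι, so that identities of commutative rings with
-- integer constants (signs ±1, zero entries) are decided by normalisation.
module IntegerCoefficients {ℓ₁ ℓ₂} (R : CommutativeRing ℓ₁ ℓ₂) where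
  open CommutativeRing R
  open import Algebra.Properties.Ring ring
    using (-1*x≈-x; -‿involutive; -0#≈0#; -‿+-comm)
  open import Algebra.Properties.CommutativeSemigroup *-commutativeSemigroup
    using (interchange)
  open import Algebra.Properties.Semiring.Mult.TCOptimised semiring
    using (_×_; 1+×; ×-homo-+; ×1-homo-*)
  open import Relation.Binary.Reasoning.Setoid setoid

  natural : ℕ → Carrier
  natural n = n × 1#

  ι : ℤ → Carrier
  ι (+ n)    = natural n
  ι -[1+ n ] = - natural (suc n)

  ι-neg : ∀ i → ι (ℤ.- i) ≈ - ι i
  ι-neg (+ zero)  = sym -0#≈0#
  ι-neg (+ suc n) = refl
  ι-neg -[1+ n ]  = sym (-‿involutive _)

  difference-suc : ∀ x y → x - y ≈ (1# + x) - (1# + y)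
  difference-suc x y = begin
    x - y                   ≈⟨ +-identityˡ _ ⟨
    0# + (x - y)            ≈⟨ +-congʳ (-‿inverseʳ 1#) ⟨
    (1# - 1#) + (x - y)     ≈⟨ +-assoc _ _ _ ⟩
    1# + (- 1# + (x - y))   ≈⟨ +-congˡ (+-assoc _ _ _) ⟨
    1# + ((- 1# + x) - y)   ≈⟨ +-congˡ (+-congʳ (+-comm _ _)) ⟩
    1# + ((x - 1#) - y)     ≈⟨ +-congˡ (+-assoc _ _ _) ⟩
    1# + (x + (- 1# - y))   ≈⟨ +-assoc _ _ _ ⟨
    (1# + x) + (- 1# - y)   ≈⟨ +-congˡ (-‿+-comm 1# y) ⟩
    (1# + x) - (1# + y)     ∎

  -- Mixed-sign sums are differences m ⊖ n of naturals.
  ι-⊖ : ∀ m n → ι (m ⊖ n) ≈ natural m - natural n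
  ι-⊖ zero    zero    = sym (-‿inverseʳ 0#)
  ι-⊖ zero    (suc n) = sym (+-identityˡ _)
  ι-⊖ (suc m) zero    = sym (trans (+-congˡ -0#≈0#) (+-identityʳ _))
  ι-⊖ (suc m) (suc n) = begin
    ι (suc m ⊖ suc n)                     ≡⟨ ≡.cong ι (ℤP.[1+m]⊖[1+n]≡m⊖n m n) ⟩
    ι (m ⊖ n)                             ≈⟨ ι-⊖ m n ⟩
    natural m - natural n                 ≈⟨ difference-suc _ _ ⟩
    (1# + natural m) - (1# + natural n)   ≈⟨ +-cong (1+× m 1#) (-‿cong (1+× n 1#)) ⟨
    natural (suc m) - natural (suc n)     ∎

  ι-+ : ∀ i j → ι (i ℤ.+ j) ≈ ι i + ι j
  ι-+ (+ m)    (+ n)    = ×-homo-+ 1# m n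
  ι-+ (+ m)    -[1+ n ] = ι-⊖ m (suc n)
  ι-+ -[1+ m ] (+ n)    = trans (ι-⊖ n (suc m)) (+-comm _ _)
  ι-+ -[1+ m ] -[1+ n ] = begin
    - natural (suc (suc (m ℕ.+ n)))        ≡⟨ ≡.cong (λ x → - natural x) (ℕP.+-suc (suc m) n) ⟨
    - natural (suc m ℕ.+ suc n)            ≈⟨ -‿cong (×-homo-+ 1# (suc m) (suc n)) ⟩
    - (natural (suc m) + natural (suc n))  ≈⟨ -‿+-comm _ _ ⟨
    - natural (suc m) - natural (suc n)    ∎

  -- Integer multiplication is defined through signs and absolute values.
  sign : Sign → Carrier
  sign Sign.+ = 1#
  sign Sign.- = - 1#

  sign-* : ∀ s t → sign (s Sign.* t) ≈ sign s * sign t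
  sign-* Sign.+ t       = sym (*-identityˡ _)
  sign-* Sign.- Sign.+  = sym (*-identityʳ _)
  sign-* Sign.- Sign.-  = sym (trans (-1*x≈-x _) (-‿involutive _))

  ι-◃ : ∀ s n → ι (s ℤ.◃ n) ≈ sign s * natural n
  ι-◃ s       zero    = sym (zeroʳ _)
  ι-◃ Sign.+ (suc n) = sym (*-identityˡ _)
  ι-◃ Sign.- (suc n) = sym (-1*x≈-x _)

  ι-sign-abs : ∀ i → ι i ≈ sign (ℤ.sign i) * natural ℤ.∣ i ∣
  ι-sign-abs (+ n)    = sym (*-identityˡ _)
  ι-sign-abs -[1+ n ] = sym (-1*x≈-x _)

  ι-* : ∀ i j → ι (i ℤ.* j) ≈ ι i * ι j
  ι-* i j = begin
    ι (i ℤ.* j)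
      ≈⟨ ι-◃ (ℤ.sign i Sign.* ℤ.sign j) (ℤ.∣ i ∣ ℕ.* ℤ.∣ j ∣) ⟩
    sign (ℤ.sign i Sign.* ℤ.sign j) * natural (ℤ.∣ i ∣ ℕ.* ℤ.∣ j ∣)
      ≈⟨ *-cong (sign-* (ℤ.sign i) (ℤ.sign j)) (×1-homo-* ℤ.∣ i ∣ ℤ.∣ j ∣) ⟩
    (sign (ℤ.sign i) * sign (ℤ.sign j)) * (natural ℤ.∣ i ∣ * natural ℤ.∣ j ∣)
      ≈⟨ interchange _ _ _ _ ⟩
    (sign (ℤ.sign i) * natural ℤ.∣ i ∣) * (sign (ℤ.sign j) * natural ℤ.∣ j ∣)
      ≈⟨ *-cong (ι-sign-abs i) (ι-sign-abs j) ⟨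
    ι i * ι j ∎

  homomorphism : ℤ.+-*-rawRing -Raw-AlmostCommutative⟶ fromCommutativeRing R
  homomorphism = record
    { ⟦_⟧ = ι ; +-homo = ι-+ ; *-homo = ι-* ; -‿homo = ι-neg ; 0-homo = refl ; 1-homo = refl }

  ι-equal? : ∀ i j → Maybe (ι i ≈ ι j)
  ι-equal? i j with i ℤ.≟ j
  ... | yes ≡.refl = just refl
  ... | no _       = nothing

  open import Algebra.Solver.Ring ℤ.+-*-rawRing (fromCommutativeRing R) homomorphism ι-equal? public
    using (Polynomial; solve; _:=_; _:+_; _:*_; _:-_; :-_; con)

  -- Polynomials in n variables as a raw ring, so that generic definitions
  -- can be instantiated symbolically and handed to the solver.
  polynomials : ℕ → RawRing _ _
  polynomials n = record
    { Carrier = Polynomial n ; _≈_ = _≡_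
    ; _+_ = _:+_ ; _*_ = _:*_ ; -_ = :-_ ; 0# = con (+ 0) ; 1# = con (+ 1) }

-- Vectors and 3×3 matrices over a raw ring.  They are defined generically so
-- that the same definitions describe both elements of R and the symbolic
-- polynomials given to the solver.
module Linear3 {ℓ₁ ℓ₂} (S : RawRing ℓ₁ ℓ₂) where
  open RawRing S

  Vector : Set ℓ₁
  Vector = Fin 3 → Carrier

  Matrix3 : Set ℓ₁
  Matrix3 = Fin 3 → Fin 3 → Carrier

  vec : Carrier → Carrier → Carrier → Vector
  vec x y z 0F = x
  vec x y z 1F = y
  vec x y z 2F = z

  columns : Vector → Vector → Vector → Matrix3
  columns u v w i 0F = u i
  columns u v w i 1F = v i
  columns u v w i 2F = w i

  column : Matrix3 → Fin 3 → Vector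
  column M l i = M i l

  e₁ e₂ e₃ : Vector
  e₁ = vec 1# 0# 0#
  e₂ = vec 0# 1# 0#
  e₃ = vec 0# 0# 1#

  identity : Matrix3
  identity = columns e₁ e₂ e₃

  companion : Carrier → Carrier → Carrier → Matrix3
  companion α β γ = columns e₂ e₃ (vec α β γ)

  infixr 7 _·_
  _·_ : Matrix3 → Vector → Vector
  (M · x) i = M i 0F * x 0F + M i 1F * x 1F + M i 2F * x 2F

  triple : Vector → Vector → Vector → Carrier
  triple u v w =
      u 0F * (v 1F * w 2F + - (w 1F * v 2F))
    + - (v 0F * (u 1F * w 2F + - (w 1F * u 2F)))
    + w 0F * (u 1F * v 2F + - (v 1F * u 2F))

  ∣_∣ : Matrix3 → Carrier
  ∣ M ∣ = triple (column M 0F) (column M 1F) (column M 2F)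

module Development {ℓ₁ ℓ₂} (R : CommutativeRing ℓ₁ ℓ₂) where
  open CommutativeRing R hiding (zero)
  open WithRing R
  open IntegerCoefficients R
  open Linear3 rawRing
  open import Algebra.Properties.Ring ring using (-‿distribˡ-*)
  open import Relation.Binary.Reasoning.Setoid setoid

  module Sym {n} = Linear3 (polynomials n)

  :0 :1 : ∀ {n} → Polynomial n
  :0 = con (+ 0)
  :1 = con (+ 1)

  ∑-cong : ∀ n {f g : Fin n → Carrier} → (∀ j → f j ≈ g j) → ∑ n f ≈ ∑ n g
  ∑-cong zero    f≈g = refl
  ∑-cong (suc n) f≈g = +-cong (f≈g zero) (∑-cong n (λ j → f≈g (suc j)))

  ∑-zero : ∀ n {f : Fin n → Carrier} → (∀ j → f j ≈ 0#) → ∑ n f ≈ 0#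
  ∑-zero zero    f≈0 = refl
  ∑-zero (suc n) f≈0 = trans (+-cong (f≈0 zero) (∑-zero n (λ j → f≈0 (suc j)))) (+-identityʳ 0#)

  det-cong : ∀ n {M N : Matrix n} → (∀ i j → M i j ≈ N i j) → det n M ≈ det n N
  det-cong zero    M≈N = refl
  det-cong (suc n) M≈N = ∑-cong (suc n) (λ j →
    *-congˡ {sgn (toℕ j)} (*-cong (M≈N zero j) (det-cong n (λ i l → M≈N (suc i) (punchIn j l)))))

  minor : ∀ {n} → Matrix (suc n) → Fin (suc n) → Matrix n
  minor M j t u = M (suc t) (punchIn j u)

  term-zero-entry : ∀ s {x} d → x ≈ 0# → s * (x * d) ≈ 0#
  term-zero-entry s d x≈0 = trans (*-congˡ (trans (*-congʳ x≈0) (zeroˡ d))) (zeroʳ s)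

  term-zero-minor : ∀ s x {d} → d ≈ 0# → s * (x * d) ≈ 0#
  term-zero-minor s x d≈0 = trans (*-congˡ (trans (*-congˡ d≈0) (zeroʳ x))) (zeroʳ s)

  det-zero-column : ∀ n (M : Matrix (suc n)) → (∀ t → M t zero ≈ 0#) → det (suc n) M ≈ 0#
  det-zero-column zero    M col≈0 = trans (+-congʳ (term-zero-entry 1# _ (col≈0 zero))) (+-identityʳ 0#)
  det-zero-column (suc n) M col≈0 = trans
    (+-cong (term-zero-entry 1# _ (col≈0 zero))
            (∑-zero (suc n) (λ j → term-zero-minor (sgn (toℕ (suc j))) (M zero (suc j))
               (det-zero-column n (minor M (suc j)) (λ t → col≈0 (suc t))))))
    (+-identityʳ 0#)

  det-first-column : ∀ n (M : Matrix (suc n)) → (∀ t → M (suc t) zero ≈ 0#) →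
                     det (suc n) M ≈ M zero zero * det n (minor M zero)
  det-first-column zero    M col≈0 = trans (+-identityʳ _) (*-identityˡ _)
  det-first-column (suc n) M col≈0 = trans
    (+-congˡ (∑-zero (suc n) (λ j → term-zero-minor (sgn (toℕ (suc j))) (M zero (suc j))
       (det-zero-column n (minor M (suc j)) col≈0))))
    (trans (+-identityʳ _) (*-identityˡ _))

  det-expand₂ : ∀ n (M : Matrix (2 ℕ.+ n)) → (∀ j → M zero (suc (suc j)) ≈ 0#) →
                det (2 ℕ.+ n) M ≈ M 0F 0F * det (suc n) (minor M 0F) - M 0F 1F * det (suc n) (minor M 1F)
  det-expand₂ n M row≈0 = trans
    (+-congˡ (+-congˡ (∑-zero n (λ j → term-zero-entry (sgn (toℕ (suc (suc j)))) _ (row≈0 j)))))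
    (solve 4 (λ p q r s → :1 :* (p :* q) :+ (:- :1 :* (r :* s) :+ :0) := p :* q :- r :* s) refl _ _ _ _)

  det-expand₃ : ∀ n (M : Matrix (3 ℕ.+ n)) → (∀ j → M zero (suc (suc (suc j))) ≈ 0#) →
                det (3 ℕ.+ n) M ≈ M 0F 0F * det (2 ℕ.+ n) (minor M 0F) - M 0F 1F * det (2 ℕ.+ n) (minor M 1F)
                                   + M 0F 2F * det (2 ℕ.+ n) (minor M 2F)
  det-expand₃ n M row≈0 = trans
    (+-congˡ (+-congˡ (+-congˡ (∑-zero n (λ j → term-zero-entry (sgn (toℕ (suc (suc (suc j))))) _ (row≈0 j))))))
    (solve 6 (λ p q r s u v → :1 :* (p :* q) :+ (:- :1 :* (r :* s) :+ (:- (:- :1) :* (u :* v) :+ :0))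
                              := p :* q :- r :* s :+ u :* v) refl _ _ _ _ _ _)

  det₁ : ∀ (M : Matrix 1) → det 1 M ≈ M 0F 0F
  det₁ M = trans (+-identityʳ _) (trans (*-identityˡ _) (*-identityʳ _))

  det₂ : ∀ (M : Matrix 2) → det 2 M ≈ M 0F 0F * M 1F 1F - M 0F 1F * M 1F 0F
  det₂ M = trans (det-expand₂ 0 M (λ ()))
    (+-cong (*-congˡ (det₁ (minor M 0F))) (-‿cong (*-congˡ (det₁ (minor M 1F)))))

  det₃ : ∀ (M : Matrix 3) → det 3 M ≈ ∣ M ∣
  det₃ M = trans (det-expand₃ 0 M (λ ()))
    (+-cong (+-cong (*-congˡ (det₂ (minor M 0F))) (-‿cong (*-congˡ (det₂ (minor M 1F)))))
            (*-congˡ (det₂ (minor M 2F))))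

  det3cols-triple : ∀ u v w → det3cols u v w ≈ triple u v w
  det3cols-triple u v w = det₃ (columns u v w)

  triple-cong : ∀ {u u′ v v′ w w′ : Vector} → (∀ i → u i ≈ u′ i) → (∀ i → v i ≈ v′ i) → (∀ i → w i ≈ w′ i) →
                triple u v w ≈ triple u′ v′ w′
  triple-cong u≈ v≈ w≈ =
    +-cong (+-cong (*-cong (u≈ 0F) (+-cong (*-cong (v≈ 1F) (w≈ 2F)) (-‿cong (*-cong (w≈ 1F) (v≈ 2F)))))
                   (-‿cong (*-cong (v≈ 0F) (+-cong (*-cong (u≈ 1F) (w≈ 2F)) (-‿cong (*-cong (w≈ 1F) (u≈ 2F)))))))
           (*-cong (w≈ 0F) (+-cong (*-cong (u≈ 1F) (v≈ 2F)) (-‿cong (*-cong (v≈ 1F) (u≈ 2F)))))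

  triple-cong₂₃ : ∀ u {v v′ w w′ : Vector} → (∀ i → v i ≈ v′ i) → (∀ i → w i ≈ w′ i) → triple u v w ≈ triple u v′ w′
  triple-cong₂₃ u = triple-cong {u} {u} (λ _ → refl)

  triple-cong₃ : ∀ u v {w w′ : Vector} → (∀ i → w i ≈ w′ i) → triple u v w ≈ triple u v w′
  triple-cong₃ u v = triple-cong₂₃ u {v} {v} (λ _ → refl)

  ·-cong : ∀ M {x y : Vector} → (∀ i → x i ≈ y i) → ∀ i → (M · x) i ≈ (M · y) i
  ·-cong M x≈y i = +-cong (+-cong (*-congˡ (x≈y 0F)) (*-congˡ (x≈y 1F))) (*-congˡ (x≈y 2F))

  triple-product : ∀ M x y z → triple (M · x) (M · y) (M · z) ≈ ∣ M ∣ * triple x y z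
  triple-product M x y z = solve 18
    (λ m₀₀ m₀₁ m₀₂ m₁₀ m₁₁ m₁₂ m₂₀ m₂₁ m₂₂ x₀ x₁ x₂ y₀ y₁ y₂ z₀ z₁ z₂ →
      let N = Sym.columns (Sym.vec m₀₀ m₁₀ m₂₀) (Sym.vec m₀₁ m₁₁ m₂₁) (Sym.vec m₀₂ m₁₂ m₂₂)
          x′ = Sym.vec x₀ x₁ x₂ ; y′ = Sym.vec y₀ y₁ y₂ ; z′ = Sym.vec z₀ z₁ z₂
      in Sym.triple (N Sym.· x′) (N Sym.· y′) (N Sym.· z′) := Sym.∣ N ∣ :* Sym.triple x′ y′ z′)
    refl (M 0F 0F) (M 0F 1F) (M 0F 2F) (M 1F 0F) (M 1F 1F) (M 1F 2F) (M 2F 0F) (M 2F 1F) (M 2F 2F)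
         (x 0F) (x 1F) (x 2F) (y 0F) (y 1F) (y 2F) (z 0F) (z 1F) (z 2F)

  ·-combination : ∀ M α β γ u v w i →
    (M · (λ x → α * u x + β * v x + γ * w x)) i ≈ α * (M · u) i + β * (M · v) i + γ * (M · w) i
  ·-combination M α β γ u v w i = solve 15
    (λ m₀ m₁ m₂ α β γ u₀ u₁ u₂ v₀ v₁ v₂ w₀ w₁ w₂ →
      let act = λ x₀ x₁ x₂ → m₀ :* x₀ :+ m₁ :* x₁ :+ m₂ :* x₂
      in act (α :* u₀ :+ β :* v₀ :+ γ :* w₀) (α :* u₁ :+ β :* v₁ :+ γ :* w₁) (α :* u₂ :+ β :* v₂ :+ γ :* w₂)
         := α :* act u₀ u₁ u₂ :+ β :* act v₀ v₁ v₂ :+ γ :* act w₀ w₁ w₂)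
    refl (M i 0F) (M i 1F) (M i 2F) α β γ (u 0F) (u 1F) (u 2F) (v 0F) (v 1F) (v 2F) (w 0F) (w 1F) (w 2F)

  ·-unit : ∀ M l i → (M · column identity l) i ≈ M i l
  ·-unit M 0F i = solve 3 (λ p q r → p :* :1 :+ q :* :0 :+ r :* :0 := p) refl (M i 0F) (M i 1F) (M i 2F)
  ·-unit M 1F i = solve 3 (λ p q r → p :* :0 :+ q :* :1 :+ r :* :0 := q) refl (M i 0F) (M i 1F) (M i 2F)
  ·-unit M 2F i = solve 3 (λ p q r → p :* :0 :+ q :* :0 :+ r :* :1 := r) refl (M i 0F) (M i 1F) (M i 2F)

  shift : ℕ → (ℕ → Carrier) → ℕ → Carrier
  shift k f j = f (k ℕ.+ j)

  W : (a b c : ℕ → Carrier) → ℕ → Vector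
  W = col identity

  B : (a b c : ℕ → Carrier) → Matrix3
  B a b c = companion (a 1) (b 2) (c 3)

  col-image : ∀ M A A′ a b c → (∀ l i → (M · column A l) i ≈ A′ i l) →
              ∀ j i → (M · col A a b c (suc j)) i ≈ col A′ a b c (suc j) i
  col-image M A A′ a b c initial 0 i = initial 0F i
  col-image M A A′ a b c initial 1 i = initial 1F i
  col-image M A A′ a b c initial 2 i = initial 2F i
  col-image M A A′ a b c initial (suc (suc (suc j))) i = begin
    (M · col A a b c (4 ℕ.+ j)) i
      ≈⟨ ·-combination M (a (suc j)) (b (2 ℕ.+ j)) (c (3 ℕ.+ j))
           (col A a b c (suc j)) (col A a b c (2 ℕ.+ j)) (col A a b c (3 ℕ.+ j)) i ⟩
    a (suc j) * (M · col A a b c (1 ℕ.+ j)) i + b (2 ℕ.+ j) * (M · col A a b c (2 ℕ.+ j)) i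
      + c (3 ℕ.+ j) * (M · col A a b c (3 ℕ.+ j)) i
      ≈⟨ +-cong (+-cong (*-congˡ (col-image M A A′ a b c initial j i))
                        (*-congˡ (col-image M A A′ a b c initial (suc j) i)))
                (*-congˡ (col-image M A A′ a b c initial (suc (suc j)) i)) ⟩
    col A′ a b c (4 ℕ.+ j) i ∎

  col-tail : ∀ A A′ a b c → (∀ l i → A′ i l ≈ col A a b c (2 ℕ.+ toℕ l) i) →
             ∀ j i → col A a b c (suc (suc j)) i ≈ col A′ (shift 1 a) (shift 1 b) (shift 1 c) (suc j) i
  col-tail A A′ a b c initial 0 i = sym (initial 0F i)
  col-tail A A′ a b c initial 1 i = sym (initial 1F i)
  col-tail A A′ a b c initial 2 i = sym (initial 2F i)
  col-tail A A′ a b c initial (suc (suc (suc j))) i =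
    +-cong (+-cong (*-congˡ (col-tail A A′ a b c initial j i))
                   (*-congˡ (col-tail A A′ a b c initial (suc j) i)))
           (*-congˡ (col-tail A A′ a b c initial (suc (suc j)) i))

  col-as-product : ∀ A a b c j i → col A a b c (suc j) i ≈ (A · W a b c (suc j)) i
  col-as-product A a b c j i = sym (col-image A identity A a b c (·-unit A) j i)

  companion-W₄ : ∀ a b c i → B a b c i 2F ≈ W a b c 4 i
  companion-W₄ a b c 0F = solve 3 (λ α β γ → α := α :* :1 :+ β :* :0 :+ γ :* :0) refl (a 1) (b 2) (c 3)
  companion-W₄ a b c 1F = solve 3 (λ α β γ → β := α :* :0 :+ β :* :1 :+ γ :* :0) refl (a 1) (b 2) (c 3)
  companion-W₄ a b c 2F = solve 3 (λ α β γ → γ := α :* :0 :+ β :* :0 :+ γ :* :1) refl (a 1) (b 2) (c 3)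

  W-shift : ∀ a b c j i → W a b c (2 ℕ.+ j) i ≈ (B a b c · W (shift 1 a) (shift 1 b) (shift 1 c) (suc j)) i
  W-shift a b c j i = begin
    W a b c (2 ℕ.+ j) i                                 ≈⟨ col-tail identity (B a b c) a b c initial j i ⟩
    col (B a b c) (shift 1 a) (shift 1 b) (shift 1 c) (suc j) i
      ≈⟨ col-image (B a b c) identity (B a b c) _ _ _ (·-unit (B a b c)) j i ⟨
    (B a b c · W (shift 1 a) (shift 1 b) (shift 1 c) (suc j)) i ∎
    where
    initial : ∀ l i → B a b c i l ≈ W a b c (2 ℕ.+ toℕ l) i
    initial 0F i = refl
    initial 1F i = refl
    initial 2F i = companion-W₄ a b c i

  W-shift² : ∀ a b c j i →
    W a b c (3 ℕ.+ j) i ≈ (B a b c · B (shift 1 a) (shift 1 b) (shift 1 c) · W (shift 2 a) (shift 2 b) (shift 2 c) (suc j)) i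
  W-shift² a b c j i = trans (W-shift a b c (suc j) i) (·-cong (B a b c) (W-shift (shift 1 a) (shift 1 b) (shift 1 c) j) i)

  W-shift³ : ∀ a b c j i →
    W a b c (4 ℕ.+ j) i ≈ (B a b c · B (shift 1 a) (shift 1 b) (shift 1 c) · B (shift 2 a) (shift 2 b) (shift 2 c)
                             · W (shift 3 a) (shift 3 b) (shift 3 c) (suc j)) i
  W-shift³ a b c j i = trans (W-shift a b c (2 ℕ.+ j) i) (·-cong (B a b c) (W-shift² (shift 1 a) (shift 1 b) (shift 1 c) j) i)

  ∣companion∣ : ∀ α β γ → ∣ companion α β γ ∣ ≈ α
  ∣companion∣ α β γ = solve 3 (λ α β γ → Sym.∣ Sym.companion α β γ ∣ := α) refl α β γ

  prodA-shift : ∀ a k → prodA a (suc k) ≈ a 1 * prodA (shift 1 a) k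
  prodA-shift a zero    = trans (*-identityˡ _) (sym (*-identityʳ _))
  prodA-shift a (suc k) = trans (*-congʳ (prodA-shift a k)) (*-assoc _ _ _)

  -- Peeling k companion matrices off det [W_{k+1} | W_{k+1+j₁} | W_{k+1+j₂}].
  peel : ∀ k a b c j₁ j₂ →
    triple (W a b c (suc k)) (W a b c (suc (k ℕ.+ j₁))) (W a b c (suc (k ℕ.+ j₂)))
      ≈ prodA a k * triple e₁ (W (shift k a) (shift k b) (shift k c) (suc j₁)) (W (shift k a) (shift k b) (shift k c) (suc j₂))
  peel zero    a b c j₁ j₂ = sym (*-identityˡ _)
  peel (suc k) a b c j₁ j₂ = begin
    triple (W a b c (2 ℕ.+ k)) (W a b c (2 ℕ.+ (k ℕ.+ j₁))) (W a b c (2 ℕ.+ (k ℕ.+ j₂)))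
      ≈⟨ triple-cong (W-shift a b c k) (W-shift a b c (k ℕ.+ j₁)) (W-shift a b c (k ℕ.+ j₂)) ⟩
    triple (B a b c · W′ (suc k)) (B a b c · W′ (suc (k ℕ.+ j₁))) (B a b c · W′ (suc (k ℕ.+ j₂)))
      ≈⟨ triple-product (B a b c) (W′ (suc k)) (W′ (suc (k ℕ.+ j₁))) (W′ (suc (k ℕ.+ j₂))) ⟩
    ∣ B a b c ∣ * triple (W′ (suc k)) (W′ (suc (k ℕ.+ j₁))) (W′ (suc (k ℕ.+ j₂)))
      ≈⟨ *-cong (∣companion∣ _ _ _) (peel k (shift 1 a) (shift 1 b) (shift 1 c) j₁ j₂) ⟩
    a 1 * (prodA (shift 1 a) k * _)   ≈⟨ *-assoc _ _ _ ⟨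
    (a 1 * prodA (shift 1 a) k) * _   ≈⟨ *-congʳ (prodA-shift a k) ⟨
    prodA a (suc k) * _ ∎
    where W′ = W (shift 1 a) (shift 1 b) (shift 1 c)

  -- Each comparison made by Pentry has the same outcome after cancelling a
  -- common successor, so P is invariant under shifting both indices together
  -- with the coefficient sequences.
  Pentry-shift₁ : ∀ a b c i j → Pentry a b c (suc i) (suc j) ≡ Pentry (shift 1 a) (shift 1 b) (shift 1 c) i j
  Pentry-shift₁ a b c i j with suc i ≟ℕ suc j | i ≟ℕ j
  ... | yes _ | yes _ = ≡.refl
  ... | yes p | no ¬p = ⊥-elim (¬p (ℕP.suc-injective p))
  ... | no ¬p | yes p = ⊥-elim (¬p (≡.cong suc p))
  ... | no _  | no _ with suc i ≟ℕ suc (j ℕ.+ 1) | i ≟ℕ j ℕ.+ 1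
  ...   | yes _ | yes _ = ≡.refl
  ...   | yes p | no ¬p = ⊥-elim (¬p (ℕP.suc-injective p))
  ...   | no ¬p | yes p = ⊥-elim (¬p (≡.cong suc p))
  ...   | no _  | no _ with suc i ≟ℕ suc (j ℕ.+ 2) | i ≟ℕ j ℕ.+ 2
  ...     | yes _ | yes _ = ≡.refl
  ...     | yes p | no ¬p = ⊥-elim (¬p (ℕP.suc-injective p))
  ...     | no ¬p | yes p = ⊥-elim (¬p (≡.cong suc p))
  ...     | no _  | no _ with suc i ≟ℕ suc (j ℕ.+ 3) | i ≟ℕ j ℕ.+ 3
  ...       | yes _ | yes _ = ≡.refl
  ...       | yes p | no ¬p = ⊥-elim (¬p (ℕP.suc-injective p))
  ...       | no ¬p | yes p = ⊥-elim (¬p (≡.cong suc p))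
  ...       | no _  | no _ = ≡.refl

  Pentry-shift : ∀ k a b c i j → Pentry a b c (k ℕ.+ i) (k ℕ.+ j) ≡ Pentry (shift k a) (shift k b) (shift k c) i j
  Pentry-shift zero    a b c i j = ≡.refl
  Pentry-shift (suc k) a b c i j =
    ≡.trans (Pentry-shift₁ a b c (k ℕ.+ i) (k ℕ.+ j)) (Pentry-shift k (shift 1 a) (shift 1 b) (shift 1 c) i j)

  coreMatrix : (a b c : ℕ → Carrier) (n s : ℕ) → Matrix n
  coreMatrix a b c n s t u = Pentry a b c (2 ℕ.+ skip s (toℕ t)) (1 ℕ.+ toℕ u)

  Qrow-skip : ∀ k s t → Qrow k (suc (k ℕ.+ s)) t ≡ k ℕ.+ (2 ℕ.+ skip s t)
  Qrow-skip k s t with k ℕ.+ 2 ℕ.+ t <?ℕ suc (k ℕ.+ s) ℕ.+ 1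
  ... | yes below = ≡.trans (ℕP.+-assoc k 2 t) (≡.cong (λ x → k ℕ.+ (2 ℕ.+ x)) (≡.sym (skip-below s t (Qrow-test⇒< k below))))
  ... | no ¬below = ≡.trans (ℕP.+-assoc k 3 t) (≡.cong (λ x → k ℕ.+ (2 ℕ.+ x)) (≡.sym (skip-above s t
                      (ℕP.≮⇒≥ (λ t<s → ¬below (<⇒Qrow-test k t<s))))))

  shifted : ((a b c : ℕ → Carrier) → ℕ → ℕ → Carrier) → ℕ → (a b c : ℕ → Carrier) → ℕ → ℕ → Carrier
  shifted F k a b c = F (shift k a) (shift k b) (shift k c)

  record CoreRecurrence (F : (a b c : ℕ → Carrier) → ℕ → ℕ → Carrier) : Set (ℓ₁ ⊔ ℓ₂) where
    field
      init₀₀ : ∀ a b c → F a b c 0 0 ≈ 1#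
      init₁₀ : ∀ a b c → F a b c 1 0 ≈ c 3
      init₂₀ : ∀ a b c → F a b c 2 0 ≈ c 3 * c 4 + b 3
      init₁₁ : ∀ a b c → F a b c 1 1 ≈ b 2
      init₂₂ : ∀ a b c → F a b c 2 2 ≈ b 2 * b 3 - a 2 * c 3
      step₀  : ∀ a b c n → F a b c (3 ℕ.+ n) 0 ≈
        c 3 * shifted F 1 a b c (2 ℕ.+ n) 0 + b 3 * shifted F 2 a b c (1 ℕ.+ n) 0 + a 3 * shifted F 3 a b c n 0
      step₁  : ∀ a b c n → F a b c (2 ℕ.+ n) 1 ≈
        b 2 * shifted F 1 a b c (1 ℕ.+ n) 0 + a 2 * shifted F 2 a b c n 0
      step₂  : ∀ a b c n → F a b c (3 ℕ.+ n) 2 ≈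
        b 2 * shifted F 1 a b c (2 ℕ.+ n) 1 - a 2 * c 3 * shifted F 2 a b c (1 ℕ.+ n) 0
      step₃  : ∀ a b c n s → F a b c (3 ℕ.+ n) (3 ℕ.+ s) ≈
        b 2 * shifted F 1 a b c (2 ℕ.+ n) (2 ℕ.+ s) - a 2 * c 3 * shifted F 2 a b c (1 ℕ.+ n) (1 ℕ.+ s)
          - a 2 * a 3 * shifted F 3 a b c n s

  open CoreRecurrence

  matching : ∀ {x y u v} → x ≈ u → y ≈ v → u ≈ v → x ≈ y
  matching x≈u y≈v u≈v = trans x≈u (trans u≈v (sym y≈v))

  recurrence-unique : ∀ {F G} → CoreRecurrence F → CoreRecurrence G →
                      ∀ n s → s ℕ.≤ n → ∀ a b c → F a b c n s ≈ G a b c n s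
  recurrence-unique F G 0 0 _ a b c = trans (init₀₀ F a b c) (sym (init₀₀ G a b c))
  recurrence-unique F G 1 0 _ a b c = trans (init₁₀ F a b c) (sym (init₁₀ G a b c))
  recurrence-unique F G 2 0 _ a b c = trans (init₂₀ F a b c) (sym (init₂₀ G a b c))
  recurrence-unique F G 1 1 _ a b c = trans (init₁₁ F a b c) (sym (init₁₁ G a b c))
  recurrence-unique F G 2 2 _ a b c = trans (init₂₂ F a b c) (sym (init₂₂ G a b c))
  recurrence-unique F G (suc (suc (suc n))) 0 _ a b c = matching (step₀ F a b c n) (step₀ G a b c n)
    (+-cong (+-cong (*-congˡ (recurrence-unique F G (suc (suc n)) 0 ℕ.z≤n _ _ _))
                    (*-congˡ (recurrence-unique F G (suc n) 0 ℕ.z≤n _ _ _)))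
            (*-congˡ (recurrence-unique F G n 0 ℕ.z≤n _ _ _)))
  recurrence-unique F G (suc (suc n)) 1 _ a b c = matching (step₁ F a b c n) (step₁ G a b c n)
    (+-cong (*-congˡ (recurrence-unique F G (suc n) 0 ℕ.z≤n _ _ _))
            (*-congˡ (recurrence-unique F G n 0 ℕ.z≤n _ _ _)))
  recurrence-unique F G (suc (suc (suc n))) 2 _ a b c = matching (step₂ F a b c n) (step₂ G a b c n)
    (+-cong (*-congˡ (recurrence-unique F G (suc (suc n)) 1 (ℕ.s≤s ℕ.z≤n) _ _ _))
            (-‿cong (*-congˡ (recurrence-unique F G (suc n) 0 ℕ.z≤n _ _ _))))
  recurrence-unique F G (suc (suc (suc n))) (suc (suc (suc s))) (ℕ.s≤s (ℕ.s≤s (ℕ.s≤s s≤n))) a b c =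
    matching (step₃ F a b c n s) (step₃ G a b c n s)
      (+-cong (+-cong (*-congˡ (recurrence-unique F G (suc (suc n)) (suc (suc s)) (ℕ.s≤s (ℕ.s≤s s≤n)) _ _ _))
                      (-‿cong (*-congˡ (recurrence-unique F G (suc n) (suc s) (ℕ.s≤s s≤n) _ _ _))))
              (-‿cong (*-congˡ (recurrence-unique F G n s s≤n _ _ _))))
  recurrence-unique F G 1 (suc (suc s)) (ℕ.s≤s ())
  recurrence-unique F G 2 (suc (suc (suc s))) (ℕ.s≤s (ℕ.s≤s ()))

  -- The core determinants satisfy the recurrence: expand along the first row
  -- and peel off columns with a single entry -1; every remaining minor is a
  -- shifted core matrix.

  Δ : (a b c : ℕ → Carrier) → ℕ → ℕ → Carrier
  Δ a b c n s = det n (coreMatrix a b c n s)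

  offset-core : ∀ k a b c n s (M : Matrix n) →
    (∀ t u → M t u ≡ Pentry a b c (k ℕ.+ (2 ℕ.+ skip s (toℕ t))) (k ℕ.+ (1 ℕ.+ toℕ u))) →
    det n M ≈ shifted Δ k a b c n s
  offset-core k a b c n s M M≡ = det-cong n (λ t u → reflexive (≡.trans (M≡ t u) (Pentry-shift k a b c _ _)))

  Δ-step₀ : ∀ a b c n → Δ a b c (3 ℕ.+ n) 0 ≈
    c 3 * shifted Δ 1 a b c (2 ℕ.+ n) 0 + b 3 * shifted Δ 2 a b c (1 ℕ.+ n) 0 + a 3 * shifted Δ 3 a b c n 0
  Δ-step₀ a b c n = begin
    det (3 ℕ.+ n) M
      ≈⟨ det-expand₃ n M (λ _ → refl) ⟩
    c 3 * det (2 ℕ.+ n) (minor M 0F) - b 3 * det (2 ℕ.+ n) (minor M 1F) + a 3 * det (2 ℕ.+ n) (minor M 2F)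
      ≈⟨ +-cong (+-cong (*-congˡ minor₀) (-‿cong (*-congˡ minor₁))) (*-congˡ minor₂) ⟩
    c 3 * Δ₁ - b 3 * (- 1# * Δ₂) + a 3 * (- 1# * (- 1# * Δ₃))
      ≈⟨ solve 6 (λ a₃ b₃ c₃ x y z → c₃ :* x :- b₃ :* (:- :1 :* y) :+ a₃ :* (:- :1 :* (:- :1 :* z))
                                     := c₃ :* x :+ b₃ :* y :+ a₃ :* z) refl (a 3) (b 3) (c 3) Δ₁ Δ₂ Δ₃ ⟩
    c 3 * Δ₁ + b 3 * Δ₂ + a 3 * Δ₃ ∎
    where
    M  = coreMatrix a b c (3 ℕ.+ n) 0
    Δ₁ = shifted Δ 1 a b c (2 ℕ.+ n) 0
    Δ₂ = shifted Δ 2 a b c (1 ℕ.+ n) 0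
    Δ₃ = shifted Δ 3 a b c n 0
    minor₀ : det (2 ℕ.+ n) (minor M 0F) ≈ Δ₁
    minor₀ = offset-core 1 a b c (2 ℕ.+ n) 0 (minor M 0F) (λ _ _ → ≡.refl)
    minor₁ : det (2 ℕ.+ n) (minor M 1F) ≈ - 1# * Δ₂
    minor₁ = trans (det-first-column (suc n) (minor M 1F) (λ _ → refl))
                   (*-congˡ (offset-core 2 a b c (suc n) 0 (minor (minor M 1F) 0F) (λ _ _ → ≡.refl)))
    minor₂ : det (2 ℕ.+ n) (minor M 2F) ≈ - 1# * (- 1# * Δ₃)
    minor₂ = trans (det-first-column (suc n) (minor M 2F) (λ _ → refl))
             (*-congˡ (trans (det-first-column n (minor (minor M 2F) 0F) (λ _ → refl))
                             (*-congˡ (offset-core 3 a b c n 0 (minor (minor (minor M 2F) 0F) 0F) (λ _ _ → ≡.refl)))))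

  Δ-step₁ : ∀ a b c n → Δ a b c (2 ℕ.+ n) 1 ≈ b 2 * shifted Δ 1 a b c (1 ℕ.+ n) 0 + a 2 * shifted Δ 2 a b c n 0
  Δ-step₁ a b c n = begin
    det (2 ℕ.+ n) M
      ≈⟨ det-expand₂ n M (λ _ → refl) ⟩
    b 2 * det (1 ℕ.+ n) (minor M 0F) - a 2 * det (1 ℕ.+ n) (minor M 1F)
      ≈⟨ +-cong (*-congˡ minor₀) (-‿cong (*-congˡ minor₁)) ⟩
    b 2 * Δ₁ - a 2 * (- 1# * Δ₂)
      ≈⟨ solve 4 (λ a₂ b₂ x y → b₂ :* x :- a₂ :* (:- :1 :* y) := b₂ :* x :+ a₂ :* y) refl (a 2) (b 2) Δ₁ Δ₂ ⟩
    b 2 * Δ₁ + a 2 * Δ₂ ∎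
    where
    M  = coreMatrix a b c (2 ℕ.+ n) 1
    Δ₁ = shifted Δ 1 a b c (1 ℕ.+ n) 0
    Δ₂ = shifted Δ 2 a b c n 0
    minor₀ : det (1 ℕ.+ n) (minor M 0F) ≈ Δ₁
    minor₀ = offset-core 1 a b c (1 ℕ.+ n) 0 (minor M 0F) (λ _ _ → ≡.refl)
    minor₁ : det (1 ℕ.+ n) (minor M 1F) ≈ - 1# * Δ₂
    minor₁ = trans (det-first-column n (minor M 1F) (λ _ → refl))
                   (*-congˡ (offset-core 2 a b c n 0 (minor (minor M 1F) 0F) (λ _ _ → ≡.refl)))

  Δ-step₂ : ∀ a b c n → Δ a b c (3 ℕ.+ n) 2 ≈
    b 2 * shifted Δ 1 a b c (2 ℕ.+ n) 1 - a 2 * c 3 * shifted Δ 2 a b c (1 ℕ.+ n) 0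
  Δ-step₂ a b c n = begin
    det (3 ℕ.+ n) M
      ≈⟨ det-expand₂ (suc n) M (λ _ → refl) ⟩
    b 2 * det (2 ℕ.+ n) (minor M 0F) - a 2 * det (2 ℕ.+ n) (minor M 1F)
      ≈⟨ +-cong (*-congˡ minor₀) (-‿cong (*-congˡ minor₁)) ⟩
    b 2 * Δ₁ - a 2 * (c 3 * Δ₂ - a 3 * 0#)
      ≈⟨ solve 6 (λ a₂ a₃ b₂ c₃ x y → b₂ :* x :- a₂ :* (c₃ :* y :- a₃ :* :0) := b₂ :* x :- a₂ :* c₃ :* y)
               refl (a 2) (a 3) (b 2) (c 3) Δ₁ Δ₂ ⟩
    b 2 * Δ₁ - a 2 * c 3 * Δ₂ ∎
    where
    M  = coreMatrix a b c (3 ℕ.+ n) 2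
    Δ₁ = shifted Δ 1 a b c (2 ℕ.+ n) 1
    Δ₂ = shifted Δ 2 a b c (1 ℕ.+ n) 0
    minor₀ : det (2 ℕ.+ n) (minor M 0F) ≈ Δ₁
    minor₀ = offset-core 1 a b c (2 ℕ.+ n) 1 (minor M 0F) (λ _ _ → ≡.refl)
    minor₁ : det (2 ℕ.+ n) (minor M 1F) ≈ c 3 * Δ₂ - a 3 * 0#
    minor₁ = trans (det-expand₂ n (minor M 1F) (λ _ → refl))
      (+-cong (*-congˡ (offset-core 2 a b c (1 ℕ.+ n) 0 (minor (minor M 1F) 0F) (λ _ _ → ≡.refl)))
              (-‿cong (*-congˡ (det-zero-column n (minor (minor M 1F) 1F) (λ _ → refl)))))

  Δ-step₃ : ∀ a b c n s → Δ a b c (3 ℕ.+ n) (3 ℕ.+ s) ≈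
    b 2 * shifted Δ 1 a b c (2 ℕ.+ n) (2 ℕ.+ s) - a 2 * c 3 * shifted Δ 2 a b c (1 ℕ.+ n) (1 ℕ.+ s)
      - a 2 * a 3 * shifted Δ 3 a b c n s
  Δ-step₃ a b c n s = begin
    det (3 ℕ.+ n) M
      ≈⟨ det-expand₂ (suc n) M (λ _ → refl) ⟩
    b 2 * det (2 ℕ.+ n) (minor M 0F) - a 2 * det (2 ℕ.+ n) (minor M 1F)
      ≈⟨ +-cong (*-congˡ minor₀) (-‿cong (*-congˡ minor₁)) ⟩
    b 2 * Δ₁ - a 2 * (c 3 * Δ₂ - a 3 * (- 1# * Δ₃))
      ≈⟨ solve 7 (λ a₂ a₃ b₂ c₃ x y z → b₂ :* x :- a₂ :* (c₃ :* y :- a₃ :* (:- :1 :* z))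
                                        := b₂ :* x :- a₂ :* c₃ :* y :- a₂ :* a₃ :* z)
               refl (a 2) (a 3) (b 2) (c 3) Δ₁ Δ₂ Δ₃ ⟩
    b 2 * Δ₁ - a 2 * c 3 * Δ₂ - a 2 * a 3 * Δ₃ ∎
    where
    M  = coreMatrix a b c (3 ℕ.+ n) (3 ℕ.+ s)
    Δ₁ = shifted Δ 1 a b c (2 ℕ.+ n) (2 ℕ.+ s)
    Δ₂ = shifted Δ 2 a b c (1 ℕ.+ n) (1 ℕ.+ s)
    Δ₃ = shifted Δ 3 a b c n s
    minor₀ : det (2 ℕ.+ n) (minor M 0F) ≈ Δ₁
    minor₀ = offset-core 1 a b c (2 ℕ.+ n) (2 ℕ.+ s) (minor M 0F) (λ _ _ → ≡.refl)
    minor₁ : det (2 ℕ.+ n) (minor M 1F) ≈ c 3 * Δ₂ - a 3 * (- 1# * Δ₃)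
    minor₁ = trans (det-expand₂ n (minor M 1F) (λ _ → refl))
      (+-cong (*-congˡ (offset-core 2 a b c (1 ℕ.+ n) (1 ℕ.+ s) (minor (minor M 1F) 0F) (λ _ _ → ≡.refl)))
              (-‿cong (*-congˡ (trans (det-first-column n (minor (minor M 1F) 1F) (λ _ → refl))
                 (*-congˡ (offset-core 3 a b c n s (minor (minor (minor M 1F) 1F) 0F) (λ _ _ → ≡.refl)))))))

  Δ-recurrence : CoreRecurrence Δ
  Δ-recurrence = record
    { init₀₀ = λ a b c → refl
    ; init₁₀ = λ a b c → det₁ (coreMatrix a b c 1 0)
    ; init₂₀ = λ a b c → trans (det₂ (coreMatrix a b c 2 0))
        (solve 3 (λ b₃ c₃ c₄ → c₃ :* c₄ :- b₃ :* (:- :1) := c₃ :* c₄ :+ b₃) refl (b 3) (c 3) (c 4))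
    ; init₁₁ = λ a b c → det₁ (coreMatrix a b c 1 1)
    ; init₂₂ = λ a b c → det₂ (coreMatrix a b c 2 2)
    ; step₀  = Δ-step₀
    ; step₁  = Δ-step₁
    ; step₂  = Δ-step₂
    ; step₃  = Δ-step₃
    }

  -- The signed 2×2 minors of the columns W satisfy the same recurrence:
  -- rewrite each W with large index through companion matrices of shifted
  -- coefficients, W_{j+k} = B·B′⋯W⁽ᵏ⁾_j, after which each rule is a polynomial
  -- identity in the coefficients and the entries of the remaining vectors.

  Ζ : (a b c : ℕ → Carrier) → ℕ → ℕ → Carrier
  Ζ a b c n s = sgn s * triple e₁ (W a b c (2 ℕ.+ s)) (W a b c (3 ℕ.+ n))

  Ζ-step₀ : ∀ a b c n → Ζ a b c (3 ℕ.+ n) 0 ≈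
    c 3 * shifted Ζ 1 a b c (2 ℕ.+ n) 0 + b 3 * shifted Ζ 2 a b c (1 ℕ.+ n) 0 + a 3 * shifted Ζ 3 a b c n 0
  Ζ-step₀ a b c n = matching
    (*-congˡ (triple-cong₃ e₁ e₂ (W-shift³ a b c (2 ℕ.+ n))))
    (+-cong (+-cong (*-congˡ (*-congˡ (triple-cong₃ e₁ e₂ (W-shift² (shift 1 a) (shift 1 b) (shift 1 c) (2 ℕ.+ n)))))
                    (*-congˡ (*-congˡ (triple-cong₃ e₁ e₂ (W-shift (shift 2 a) (shift 2 b) (shift 2 c) (2 ℕ.+ n))))))
            refl)
    (solve 12 (λ α₁ β₁ γ₁ α₂ β₂ γ₂ α₃ β₃ γ₃ y₀ y₁ y₂ →
       let B₁ = Sym.companion α₁ β₁ γ₁ ; B₂ = Sym.companion α₂ β₂ γ₂ ; B₃ = Sym.companion α₃ β₃ γ₃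
           y = Sym.vec y₀ y₁ y₂
           T = λ w → :1 :* Sym.triple Sym.e₁ Sym.e₂ w
       in T (B₁ Sym.· B₂ Sym.· B₃ Sym.· y) := γ₁ :* T (B₂ Sym.· B₃ Sym.· y) :+ β₂ :* T (B₃ Sym.· y) :+ α₃ :* T y)
       refl (a 1) (b 2) (c 3) (a 2) (b 3) (c 4) (a 3) (b 4) (c 5) (y 0F) (y 1F) (y 2F))
    where y = W (shift 3 a) (shift 3 b) (shift 3 c) (3 ℕ.+ n)

  Ζ-step₁ : ∀ a b c n → Ζ a b c (2 ℕ.+ n) 1 ≈ b 2 * shifted Ζ 1 a b c (1 ℕ.+ n) 0 + a 2 * shifted Ζ 2 a b c n 0
  Ζ-step₁ a b c n = matching
    (*-congˡ (triple-cong₃ e₁ e₃ (W-shift² a b c (2 ℕ.+ n))))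
    (+-cong (*-congˡ (*-congˡ (triple-cong₃ e₁ e₂ (W-shift (shift 1 a) (shift 1 b) (shift 1 c) (2 ℕ.+ n))))) refl)
    (solve 9 (λ α₁ β₁ γ₁ α₂ β₂ γ₂ y₀ y₁ y₂ →
       let B₁ = Sym.companion α₁ β₁ γ₁ ; B₂ = Sym.companion α₂ β₂ γ₂
           y = Sym.vec y₀ y₁ y₂
           T = λ w → :1 :* Sym.triple Sym.e₁ Sym.e₂ w
       in :- :1 :* Sym.triple Sym.e₁ Sym.e₃ (B₁ Sym.· B₂ Sym.· y) := β₁ :* T (B₂ Sym.· y) :+ α₂ :* T y)
       refl (a 1) (b 2) (c 3) (a 2) (b 3) (c 4) (y 0F) (y 1F) (y 2F))
    where y = W (shift 2 a) (shift 2 b) (shift 2 c) (3 ℕ.+ n)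

  Ζ-step₂ : ∀ a b c n → Ζ a b c (3 ℕ.+ n) 2 ≈
    b 2 * shifted Ζ 1 a b c (2 ℕ.+ n) 1 - a 2 * c 3 * shifted Ζ 2 a b c (1 ℕ.+ n) 0
  Ζ-step₂ a b c n = matching
    (*-congˡ (triple-cong₂₃ e₁ (W-shift a b c 2) (W-shift² a b c (3 ℕ.+ n))))
    (+-cong (*-congˡ (*-congˡ (triple-cong₃ e₁ e₃ (W-shift (shift 1 a) (shift 1 b) (shift 1 c) (3 ℕ.+ n))))) refl)
    (solve 9 (λ α₁ β₁ γ₁ α₂ β₂ γ₂ y₀ y₁ y₂ →
       let B₁ = Sym.companion α₁ β₁ γ₁ ; B₂ = Sym.companion α₂ β₂ γ₂
           y = Sym.vec y₀ y₁ y₂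
       in :- (:- :1) :* Sym.triple Sym.e₁ (B₁ Sym.· Sym.e₃) (B₁ Sym.· B₂ Sym.· y)
          := β₁ :* (:- :1 :* Sym.triple Sym.e₁ Sym.e₃ (B₂ Sym.· y)) :- α₂ :* γ₁ :* (:1 :* Sym.triple Sym.e₁ Sym.e₂ y))
       refl (a 1) (b 2) (c 3) (a 2) (b 3) (c 4) (y 0F) (y 1F) (y 2F))
    where y = W (shift 2 a) (shift 2 b) (shift 2 c) (4 ℕ.+ n)

  Ζ-step₃ : ∀ a b c n s → Ζ a b c (3 ℕ.+ n) (3 ℕ.+ s) ≈
    b 2 * shifted Ζ 1 a b c (2 ℕ.+ n) (2 ℕ.+ s) - a 2 * c 3 * shifted Ζ 2 a b c (1 ℕ.+ n) (1 ℕ.+ s)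
      - a 2 * a 3 * shifted Ζ 3 a b c n s
  Ζ-step₃ a b c n s = matching
    (*-congˡ (triple-cong₂₃ e₁ (W-shift³ a b c (1 ℕ.+ s)) (W-shift³ a b c (2 ℕ.+ n))))
    (+-cong (+-cong (*-congˡ (*-congˡ (triple-cong₂₃ e₁ (W-shift² a′ b′ c′ (1 ℕ.+ s)) (W-shift² a′ b′ c′ (2 ℕ.+ n)))))
                    (-‿cong (*-congˡ (*-congˡ (triple-cong₂₃ e₁ (W-shift a″ b″ c″ (1 ℕ.+ s)) (W-shift a″ b″ c″ (2 ℕ.+ n)))))))
            refl)
    (solve 16 (λ σ α₁ β₁ γ₁ α₂ β₂ γ₂ α₃ β₃ γ₃ x₀ x₁ x₂ y₀ y₁ y₂ →
       let B₁ = Sym.companion α₁ β₁ γ₁ ; B₂ = Sym.companion α₂ β₂ γ₂ ; B₃ = Sym.companion α₃ β₃ γ₃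
           x = Sym.vec x₀ x₁ x₂ ; y = Sym.vec y₀ y₁ y₂
           T = Sym.triple Sym.e₁
       in :- (:- (:- σ)) :* T (B₁ Sym.· B₂ Sym.· B₃ Sym.· x) (B₁ Sym.· B₂ Sym.· B₃ Sym.· y)
          := β₁ :* (:- (:- σ) :* T (B₂ Sym.· B₃ Sym.· x) (B₂ Sym.· B₃ Sym.· y))
             :- α₂ :* γ₁ :* (:- σ :* T (B₃ Sym.· x) (B₃ Sym.· y)) :- α₂ :* α₃ :* (σ :* T x y))
       refl (sgn s) (a 1) (b 2) (c 3) (a 2) (b 3) (c 4) (a 3) (b 4) (c 5)
            (x 0F) (x 1F) (x 2F) (y 0F) (y 1F) (y 2F))
    where
    a′ = shift 1 a ; b′ = shift 1 b ; c′ = shift 1 c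
    a″ = shift 2 a ; b″ = shift 2 b ; c″ = shift 2 c
    x = W (shift 3 a) (shift 3 b) (shift 3 c) (2 ℕ.+ s)
    y = W (shift 3 a) (shift 3 b) (shift 3 c) (3 ℕ.+ n)

  -- The initial values are read off from W₂ = e₂, W₃ = e₃, W₄ = B·e₃, W₅ = B·B′·e₃.
  Ζ-recurrence : CoreRecurrence Ζ
  Ζ-recurrence = record
    { init₀₀ = λ a b c → solve 0 (:1 :* Sym.triple Sym.e₁ Sym.e₂ Sym.e₃ := :1) refl
    ; init₁₀ = λ a b c → trans (*-congˡ (triple-cong₃ e₁ e₂ (W-shift a b c 2)))
        (solve 3 (λ α β γ → :1 :* Sym.triple Sym.e₁ Sym.e₂ (Sym.companion α β γ Sym.· Sym.e₃) := γ)
           refl (a 1) (b 2) (c 3))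
    ; init₂₀ = λ a b c → trans (*-congˡ (triple-cong₃ e₁ e₂ (W-shift² a b c 2)))
        (solve 6 (λ α₁ β₁ γ₁ α₂ β₂ γ₂ →
           :1 :* Sym.triple Sym.e₁ Sym.e₂ (Sym.companion α₁ β₁ γ₁ Sym.· Sym.companion α₂ β₂ γ₂ Sym.· Sym.e₃)
           := γ₁ :* γ₂ :+ β₂) refl (a 1) (b 2) (c 3) (a 2) (b 3) (c 4))
    ; init₁₁ = λ a b c → trans (*-congˡ (triple-cong₃ e₁ e₃ (W-shift a b c 2)))
        (solve 3 (λ α β γ → :- :1 :* Sym.triple Sym.e₁ Sym.e₃ (Sym.companion α β γ Sym.· Sym.e₃) := β)
           refl (a 1) (b 2) (c 3))
    ; init₂₂ = λ a b c → trans (*-congˡ (triple-cong₂₃ e₁ (W-shift a b c 2) (W-shift² a b c 2)))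
        (solve 6 (λ α₁ β₁ γ₁ α₂ β₂ γ₂ →
           let B₁ = Sym.companion α₁ β₁ γ₁ ; B₂ = Sym.companion α₂ β₂ γ₂
           in :- (:- :1) :* Sym.triple Sym.e₁ (B₁ Sym.· Sym.e₃) (B₁ Sym.· B₂ Sym.· Sym.e₃)
              := β₁ :* β₂ :- α₂ :* γ₁) refl (a 1) (b 2) (c 3) (a 2) (b 3) (c 4))
    ; step₀  = Ζ-step₀
    ; step₁  = Ζ-step₁
    ; step₂  = Ζ-step₂
    ; step₃  = Ζ-step₃
    }

  core : ∀ n s → s ℕ.≤ n → ∀ a b c → Δ a b c n s ≈ Ζ a b c n s
  core = recurrence-unique Δ-recurrence Ζ-recurrence

  Q22-core : ∀ a b c r k s → det (r ℕ.∸ k) (Q22 a b c r k (suc (k ℕ.+ s))) ≈ shifted Δ k a b c (r ℕ.∸ k) s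
  Q22-core a b c r k s = offset-core k a b c (r ℕ.∸ k) s _
    (λ t u → ≡.cong₂ (Pentry a b c) (Qrow-skip k s (toℕ t)) (ℕP.+-assoc k 1 (toℕ u)))

  sgn-+ : ∀ x y → sgn (x ℕ.+ y) ≈ sgn x * sgn y
  sgn-+ zero    y = sym (*-identityˡ _)
  sgn-+ (suc x) y = trans (-‿cong (sgn-+ x y)) (-‿distribˡ-* _ _)

  sgn-square : ∀ x → sgn x * sgn x ≈ 1#
  sgn-square zero    = *-identityˡ 1#
  sgn-square (suc x) = trans (solve 1 (λ σ → :- σ :* :- σ := σ :* σ) refl (sgn x)) (sgn-square x)

  sgn-parity : ∀ k s → sgn (suc (k ℕ.+ s) ℕ.+ k ℕ.+ 1) ≈ sgn s
  sgn-parity k s = begin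
    sgn (suc (k ℕ.+ s) ℕ.+ k ℕ.+ 1)    ≡⟨ ≡.cong sgn (sign-index k s) ⟩
    sgn (s ℕ.+ (suc k ℕ.+ suc k))       ≈⟨ sgn-+ s _ ⟩
    sgn s * sgn (suc k ℕ.+ suc k)       ≈⟨ *-congˡ (trans (sgn-+ (suc k) (suc k)) (sgn-square (suc k))) ⟩
    sgn s * 1#                          ≈⟨ *-identityʳ _ ⟩
    sgn s                               ∎

  insert-sign : ∀ σ → σ * σ ≈ 1# → ∀ x p z → x * (p * z) ≈ σ * p * (σ * z) * x
  insert-sign σ σ²≈1 x p z = begin
    x * (p * z)                ≈⟨ *-identityˡ _ ⟨
    1# * (x * (p * z))         ≈⟨ *-congʳ σ²≈1 ⟨
    (σ * σ) * (x * (p * z))    ≈⟨ solve 4 (λ σ x p z → (σ :* σ) :* (x :* (p :* z)) := σ :* p :* (σ :* z) :* x) refl σ x p z ⟩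
    σ * p * (σ * z) * x        ∎

  -- The theorem with the indices written as k+1, k+s+2 and k+n+3 (n = r - k).
  column-formula : ∀ r k s A a b c → s ℕ.≤ r ℕ.∸ k →
    det3cols (col A a b c (suc k)) (col A a b c (suc (k ℕ.+ suc s))) (col A a b c (suc (k ℕ.+ suc (suc (r ℕ.∸ k)))))
      ≈ sgn s * prodA a k * det (r ℕ.∸ k) (Q22 a b c r k (suc (k ℕ.+ s))) * det 3 A
  column-formula r k s A a b c s≤n = begin
    det3cols (col A a b c i) (col A a b c j) (col A a b c l)
      ≈⟨ det3cols-triple (col A a b c i) (col A a b c j) (col A a b c l) ⟩
    triple (col A a b c i) (col A a b c j) (col A a b c l)
      ≈⟨ triple-cong (col-as-product A a b c k) (col-as-product A a b c (k ℕ.+ suc s))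
                     (col-as-product A a b c (k ℕ.+ suc (suc n))) ⟩
    triple (A · W a b c i) (A · W a b c j) (A · W a b c l)
      ≈⟨ triple-product A (W a b c i) (W a b c j) (W a b c l) ⟩
    ∣ A ∣ * triple (W a b c i) (W a b c j) (W a b c l)
      ≈⟨ *-congˡ (peel k a b c (suc s) (suc (suc n))) ⟩
    ∣ A ∣ * (prodA a k * Z)
      ≈⟨ insert-sign (sgn s) (sgn-square s) _ _ _ ⟩
    sgn s * prodA a k * (sgn s * Z) * ∣ A ∣
      ≈⟨ *-cong (*-congˡ (sym (trans (Q22-core a b c r k s) (core n s s≤n _ _ _)))) (sym (det₃ A)) ⟩
    sgn s * prodA a k * det n (Q22 a b c r k (suc (k ℕ.+ s))) * det 3 A ∎
    where
    n = r ℕ.∸ k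
    i = suc k
    j = suc (k ℕ.+ suc s)
    l = suc (k ℕ.+ suc (suc n))
    Z = triple e₁ (W (shift k a) (shift k b) (shift k c) (2 ℕ.+ s)) (W (shift k a) (shift k b) (shift k c) (3 ℕ.+ n))

mainTheorem3 : ∀ {ℓ₁ ℓ₂} (R : CommutativeRing ℓ₁ ℓ₂) →
    let open CommutativeRing R
        open WithRing R
    in (r : ℕ) → 1 ℕ.≤ r →
       (A : Fin 3 → Fin 3 → Carrier) (a b c : ℕ → Carrier) (k m : ℕ) →
       k ℕ.< m → m ℕ.≤ r ℕ.+ 1 →
       det3cols (col A a b c (k ℕ.+ 1)) (col A a b c (m ℕ.+ 1)) (col A a b c (r ℕ.+ 3))
         ≈ sgn (m ℕ.+ k ℕ.+ 1) * prodA a k * det (r ℕ.∸ k) (Q22 a b c r k m) * det 3 A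
mainTheorem3 R r _ A a b c k m k<m m≤r+1 with ℕP.m≤n⇒∃[o]m+o≡n k<m
... | s , ≡.refl = begin
  det3cols (col A a b c (k ℕ.+ 1)) (col A a b c (suc (k ℕ.+ s) ℕ.+ 1)) (col A a b c (r ℕ.+ 3))
    ≡⟨ cong₃ (λ i j l → det3cols (col A a b c i) (col A a b c j) (col A a b c l))
             (ℕP.+-comm k 1) (second-index k s) (third-index (ℕP.m+n≤o⇒m≤o k k+s≤r)) ⟩
  det3cols (col A a b c (suc k)) (col A a b c (suc (k ℕ.+ suc s))) (col A a b c (suc (k ℕ.+ suc (suc (r ℕ.∸ k)))))
    ≈⟨ column-formula r k s A a b c (s≤r∸k k+s≤r) ⟩
  sgn s * prodA a k * det (r ℕ.∸ k) (Q22 a b c r k m) * det 3 A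
    ≈⟨ *-congʳ (*-congʳ (*-congʳ (sgn-parity k s))) ⟨
  sgn (m ℕ.+ k ℕ.+ 1) * prodA a k * det (r ℕ.∸ k) (Q22 a b c r k m) * det 3 A ∎
  where
  open CommutativeRing R
  open WithRing R
  open Development R using (column-formula; sgn-parity)
  open import Relation.Binary.Reasoning.Setoid setoid
  k+s≤r : k ℕ.+ s ℕ.≤ r
  k+s≤r = bounded {k} {s} m≤r+1
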